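{- Let $G$ be a cycle of cliques with respect to the min-max clique covering $\{C_1,\dots,C_\ell\}$. If there are two distinct indices $i,j$ such that $C_{i,i}$ and $C_{j,j}$ are both nonempty, then $Z_+(G)=|V(G)|-\mathrm{cc}(G)$.
   Context: A clique is a set of vertices inducing a complete subgraph; maximal if no vertex can be added. A clique covering is a set of cliques such that every edge lies inside one of them; $\mathrm{cc}(G)$ is its minimum size; a min-max clique covering has size $\mathrm{cc}(G)$ and all cliques maximal. $G$ is a cycle of cliques with respect to a min-max clique covering $\{C_1,\dots,C_\ell\}$ if $C_i\cap C_{i+1}\neq\emptyset$ for $i=1,\dots,\ell-1$ and $C_1\cap C_\ell\neq\emptyset$, while all other intersections of two distinct cliques of the covering are empty. $C_{i,i}=C_i\setminus\bigcup_{j\neq i}C_j$. Positive zero forcing: a set $B$ of vertices is coloured black, the rest white; if $W_1,\dots,W_k$ are the vertex sets of the components of $G-B$ ($B$ the current black set), $u\in B$, and $w$ is the only white neighbour of $u$ in $G[W_i\cup B]$, then $w$ may be coloured black. $S$ is a positive zero forcing set if starting from $S$ black all vertices eventually become black; $Z_+(G)$ is the minimum size of such a set. -}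

module Defs where

open import Data.Nat using (ℕ; zero; suc; _≤_)
open import Data.Fin using (Fin; toℕ)
open import Data.Fin.Subset using (Subset; _∈_; _∉_; _∪_; ⁅_⁆)
open import Data.Product using (Σ; ∃; _×_; _,_)
open import Data.Sum using (_⊎_)
open import Relation.Nullary using (¬_)
open import Relation.Binary.PropositionalEquality using (_≡_; _≢_)

record Graph (n : ℕ) : Set₁ where
  field
    Adj   : Fin n → Fin n → Set
    sym   : ∀ {u v} → Adj u v → Adj v u
    irrefl : ∀ {u} → ¬ Adj u u
open Graph public

module _ {n : ℕ} (G : Graph n) where

  IsClique : Subset n → Set
  IsClique C = ∀ u v → u ∈ C → v ∈ C → u ≢ v → Adj G u v

  IsMaximalClique : Subset n → Set
  IsMaximalClique C = IsClique C × (∀ w → w ∉ C → ¬ IsClique (⁅ w ⁆ ∪ C))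

  IsCliqueCovering : {k : ℕ} → (Fin k → Subset n) → Set
  IsCliqueCovering {k} C =
    (∀ i → IsClique (C i)) ×
    (∀ u v → Adj G u v → ∃ λ i → u ∈ C i × v ∈ C i)

IsMinimum : (ℕ → Set) → ℕ → Set
IsMinimum P k = P k × (∀ m → P m → k ≤ m)

module _ {n : ℕ} (G : Graph n) where

  IsCC : ℕ → Set
  IsCC = IsMinimum (λ k → Σ (Fin k → Subset n) (λ C → IsCliqueCovering G C))

  IsMinMaxCliqueCovering : {ℓ : ℕ} → (Fin ℓ → Subset n) → Set
  IsMinMaxCliqueCovering {ℓ} C =
    IsCliqueCovering G C × IsCC ℓ × (∀ i → IsMaximalClique G (C i))

Meets : {n : ℕ} → Subset n → Subset n → Set
Meets A B = ∃ λ v → v ∈ A × v ∈ B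

-- cyclic adjacency of indices 0..ℓ-1 (i.e. C_1..C_ℓ with C_ℓ next to C_1)
CycAdj : {ℓ : ℕ} → Fin ℓ → Fin ℓ → Set
CycAdj {ℓ} i j =
  suc (toℕ i) ≡ toℕ j ⊎ suc (toℕ j) ≡ toℕ i
  ⊎ (toℕ i ≡ 0 × suc (toℕ j) ≡ ℓ) ⊎ (toℕ j ≡ 0 × suc (toℕ i) ≡ ℓ)

IsCycleOfCliques : {n ℓ : ℕ} → Graph n → (Fin ℓ → Subset n) → Set
IsCycleOfCliques {n} {ℓ} G C =
  IsMinMaxCliqueCovering G C ×
  (∀ i j → suc (toℕ i) ≡ toℕ j → Meets (C i) (C j)) ×
  (∀ i j → toℕ i ≡ 0 → suc (toℕ j) ≡ ℓ → Meets (C i) (C j)) ×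
  (∀ i j → i ≢ j → ¬ CycAdj i j → ¬ Meets (C i) (C j))

-- C_{i,i} = C_i minus the union of the other C_j is nonempty
PrivateNonempty : {n ℓ : ℕ} → (Fin ℓ → Subset n) → Fin ℓ → Set
PrivateNonempty C i = ∃ λ v → v ∈ C i × (∀ j → j ≢ i → v ∉ C j)

module _ {n : ℕ} (G : Graph n) where

  -- y is reachable from x by a path of white vertices (not in B),
  -- i.e. x and y are in the same component of G - B
  data WhiteReach (B : Subset n) : Fin n → Fin n → Set where
    here : ∀ {x} → x ∉ B → WhiteReach B x x
    step : ∀ {x y z} → x ∉ B → Adj G x y → WhiteReach B y z → WhiteReach B x z

  -- u (black) may force w: w is the only white neighbour of u in G[W ∪ B],
  -- W the component of G - B containing w
  Forces : Subset n → Fin n → Fin n → Set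
  Forces B u w =
    u ∈ B × w ∉ B × Adj G u w ×
    (∀ w' → w' ∉ B → Adj G u w' → WhiteReach B w w' → w' ≡ w)

  data CanColourAll : Subset n → Set where
    all-black : ∀ {B} → (∀ v → v ∈ B) → CanColourAll B
    force : ∀ {B} u w → Forces B u w → CanColourAll (B ∪ ⁅ w ⁆) → CanColourAll B

  IsPZFS : Subset n → Set
  IsPZFS S = CanColourAll S

  IsZPlus : ℕ → Set
  IsZPlus = IsMinimum (λ k → Σ (Subset n) (λ S → IsPZFS S × Data.Fin.Subset.∣ S ∣ ≡ k))

module Submission where

-- If u forces w, the clique of a covering that contains the edge uw has w as its last white
-- vertex: every other white vertex of it would be a second white neighbour of u in the component
-- of w. So each force completes a new clique of the covering, and |S| + cc(G) ≥ |V(G)| for every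
-- positive zero forcing set S. Conversely, relabel the cycle so that the cliques with private
-- vertices are K 0 and K J, and leave white their private vertices p₀, pJ and one vertex of
-- K m ∩ K (m+1) for each 0 < m < ℓ − 1: these ℓ = cc(G) vertices are forced in turn, p₀ first
-- by a vertex of K 0 ∩ K 1, then the intersection vertices from both ends of the cycle towards
-- K J, and pJ last. For ℓ = 3 the intersection vertices may lie in all three cliques, and the
-- third white vertex is found instead by maximality of the third clique.

open import Defs hiding (sym)
open import Data.Nat using (ℕ; zero; suc; _+_; _∸_; _≤_; _<_; z≤n; s≤s; _≟_; _≤?_)
open import Data.Nat.Properties
open import Data.Fin using (Fin; toℕ) renaming (zero to fzero; suc to fsuc)
open import Data.Fin.Properties using (toℕ-injective; toℕ<n; any?) renaming (_≟_ to _≟ᶠ_)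
open import Data.Fin.Subset using (Subset; _∈_; _∉_; _∪_; ⁅_⁆; ∣_∣; ∁; _⊆_; _⊈_; ⊤) renaming (⊥ to ∅)
open import Data.Fin.Subset.Properties
  using ( _⊆?_; _∈?_; x∈p∪q⁺; x∈p∪q⁻; x∈⁅x⁆; x∈⁅y⁆⇒x≡y; ∣⁅x⁆∣≡1; p⊂q⇒∣p∣<∣q∣
        ; p⊆q⇒∣p∣≤∣q∣; ∣⊤∣≡n; x∉∁p⇒x∈p; ∣∁p∣≡n∸∣p∣; ∣p∣≤n; ∉⊥)
open import Data.Product using (Σ; ∃; _×_; _,_; proj₁; proj₂)
open import Data.Sum using (_⊎_; inj₁; inj₂)
open import Data.Empty using (⊥; ⊥-elim)
open import Data.Bool using (true; false; not)
open import Data.Vec using (_∷_; []; tabulate)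
open import Data.Vec.Properties using (lookup∘tabulate; lookup⇒[]=; []=⇒lookup)
open import Function using (_∘_)
open import Relation.Nullary using (¬_; Dec; yes; no; does)
open import Relation.Nullary.Decidable using (_×-dec_; _⊎-dec_; ¬?; decidable-stable)
open import Relation.Binary.PropositionalEquality using (_≡_; _≢_; refl; sym; trans; cong; subst; subst₂)

∣p∪q∣≤∣p∣+∣q∣ : ∀ {n} (p q : Subset n) → ∣ p ∪ q ∣ ≤ ∣ p ∣ + ∣ q ∣
∣p∪q∣≤∣p∣+∣q∣ []          []          = z≤n
∣p∪q∣≤∣p∣+∣q∣ (true ∷ p)  (true ∷ q)  = s≤s (≤-trans (∣p∪q∣≤∣p∣+∣q∣ p q) (+-monoʳ-≤ ∣ p ∣ (n≤1+n ∣ q ∣)))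
∣p∪q∣≤∣p∣+∣q∣ (true ∷ p)  (false ∷ q) = s≤s (∣p∪q∣≤∣p∣+∣q∣ p q)
∣p∪q∣≤∣p∣+∣q∣ (false ∷ p) (true ∷ q)  = ≤-trans (s≤s (∣p∪q∣≤∣p∣+∣q∣ p q)) (≤-reflexive (sym (+-suc ∣ p ∣ ∣ q ∣)))
∣p∪q∣≤∣p∣+∣q∣ (false ∷ p) (false ∷ q) = ∣p∪q∣≤∣p∣+∣q∣ p q

∣p∪⁅x⁆∣≤1+∣p∣ : ∀ {n} (p : Subset n) x → ∣ p ∪ ⁅ x ⁆ ∣ ≤ suc ∣ p ∣
∣p∪⁅x⁆∣≤1+∣p∣ p x =
  ≤-trans (∣p∪q∣≤∣p∣+∣q∣ p ⁅ x ⁆) (≤-reflexive (trans (cong (∣ p ∣ +_) (∣⁅x⁆∣≡1 x)) (+-comm ∣ p ∣ 1)))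

x∉p⇒∣p∣<∣p∪⁅x⁆∣ : ∀ {n} {p : Subset n} {x} → x ∉ p → ∣ p ∣ < ∣ p ∪ ⁅ x ⁆ ∣
x∉p⇒∣p∣<∣p∪⁅x⁆∣ {x = x} x∉p =
  p⊂q⇒∣p∣<∣q∣ ((λ v∈p → x∈p∪q⁺ (inj₁ v∈p)) , x , x∈p∪q⁺ (inj₂ (x∈⁅x⁆ x)) , x∉p)

x≢y⇒2≤∣⁅x⁆∪⁅y⁆∣ : ∀ {n} {x y : Fin n} → x ≢ y → 2 ≤ ∣ ⁅ x ⁆ ∪ ⁅ y ⁆ ∣
x≢y⇒2≤∣⁅x⁆∪⁅y⁆∣ {x = x} x≢y = ≤-trans (s≤s (≤-reflexive (sym (∣⁅x⁆∣≡1 x))))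
  (x∉p⇒∣p∣<∣p∪⁅x⁆∣ λ y∈ → x≢y (sym (x∈⁅y⁆⇒x≡y x y∈)))

∣∁p∣+∣p∣≡n : ∀ {n} (p : Subset n) → ∣ ∁ p ∣ + ∣ p ∣ ≡ n
∣∁p∣+∣p∣≡n p = trans (cong (_+ ∣ p ∣) (∣∁p∣≡n∸∣p∣ p)) (m∸n+n≡m (∣p∣≤n p))

x∈p∪⁅y⁆⁻ : ∀ {n} {p : Subset n} {x y} → x ∈ p ∪ ⁅ y ⁆ → x ∈ p ⊎ x ≡ y
x∈p∪⁅y⁆⁻ {p = p} {y = y} x∈ with x∈p∪q⁻ p ⁅ y ⁆ x∈
... | inj₁ x∈p = inj₁ x∈p
... | inj₂ x∈y = inj₂ (x∈⁅y⁆⇒x≡y y x∈y)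

⊈⇒∃∈∉ : ∀ {n} {p q : Subset n} → p ⊈ q → ∃ λ v → v ∈ p × v ∉ q
⊈⇒∃∈∉ {p = p} {q} p⊈q with any? (λ v → v ∈? p ×-dec ¬? (v ∈? q))
... | yes witness = witness
... | no  none    = ⊥-elim (p⊈q λ {v} v∈p → decidable-stable (v ∈? q) λ v∉q → none (v , v∈p , v∉q))

∈∉⇒≢ : ∀ {n} {p : Subset n} {x y} → x ∈ p → y ∉ p → x ≢ y
∈∉⇒≢ x∈p y∉p refl = y∉p x∈p

image : ∀ {n} → (ℕ → Fin n) → ℕ → Subset n
image f zero    = ∅
image f (suc k) = image f k ∪ ⁅ f k ⁆

∈-image⁻ : ∀ {n} {f : ℕ → Fin n} k {v} → v ∈ image f k → ∃ λ m → m < k × v ≡ f m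
∈-image⁻ zero    v∈ = ⊥-elim (∉⊥ v∈)
∈-image⁻ (suc k) v∈ with x∈p∪⁅y⁆⁻ v∈
... | inj₁ v∈′ = let (m , m<k , eq) = ∈-image⁻ k v∈′ in m , ≤-trans m<k (n≤1+n k) , eq
... | inj₂ eq  = k , ≤-refl , eq

k≤∣image∣ : ∀ {n} {f : ℕ → Fin n} k → (∀ {a b} → a < k → b < k → f a ≡ f b → a ≡ b) →
  k ≤ ∣ image f k ∣
k≤∣image∣ zero    _         = z≤n
k≤∣image∣ {f = f} (suc k) injective =
  ≤-trans (s≤s (k≤∣image∣ k λ a<k b<k → injective (m≤n⇒m≤1+n a<k) (m≤n⇒m≤1+n b<k)))
          (x∉p⇒∣p∣<∣p∪⁅x⁆∣ fk∉)
  where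
  fk∉ : f k ∉ image f k
  fk∉ fk∈ with ∈-image⁻ k fk∈
  ... | m , m<k , eq = <-irrefl (sym (injective ≤-refl (m≤n⇒m≤1+n m<k) eq)) m<k

IsMinimum-unique : ∀ {P a b} → IsMinimum P a → IsMinimum P b → a ≡ b
IsMinimum-unique (Pa , a≤) (Pb , b≤) = ≤-antisym (a≤ _ Pb) (b≤ _ Pa)

PZFSLeaving : ∀ {n} → Graph n → ℕ → Set
PZFSLeaving {n} G m = Σ (Subset n) λ S → IsPZFS G S × m + ∣ S ∣ ≤ n

zplus+m≤n : ∀ {n} {G : Graph n} {z m} → IsZPlus G z → PZFSLeaving G m → z + m ≤ n
zplus+m≤n {z = z} {m} (_ , minimal) (S , pzfs , size) =
  ≤-trans (≤-reflexive (+-comm z m)) (≤-trans (+-monoʳ-≤ m (minimal ∣ S ∣ (S , pzfs , refl))) size)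

module Forcing {n : ℕ} (G : Graph n) where

  WhitesIn : (Fin n → Set) → Subset n → Set
  WhitesIn W B = ∀ v → v ∉ B → W v

  ColoursAll : (Fin n → Set) → Set
  ColoursAll W = ∀ B → WhitesIn W B → CanColourAll G B

  ForcibleIn : (Fin n → Set) → Fin n → Set
  ForcibleIn W w = ∀ B → WhitesIn W B → w ∉ B → ∃ λ u → Forces G B u w

  black-outside : ∀ {W B u} → WhitesIn W B → ¬ W u → u ∈ B
  black-outside {B = B} {u} white⊆W ¬Wu with u ∈? B
  ... | yes u∈B = u∈B
  ... | no  u∉B = ⊥-elim (¬Wu (white⊆W u u∉B))

  whiteReach-source∉ : ∀ {B x y} → WhiteReach G B x y → x ∉ B
  whiteReach-source∉ (here x∉B)     = x∉B
  whiteReach-source∉ (step x∉B _ _) = x∉B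

  forces-uniqueWhiteNeighbour : ∀ {B u w} → u ∈ B → w ∉ B → Adj G u w →
    (∀ w' → w' ∉ B → Adj G u w' → w' ≡ w) → Forces G B u w
  forces-uniqueWhiteNeighbour u∈B w∉B uw unique = u∈B , w∉B , uw , λ w' w'∉B uw' _ → unique w' w'∉B uw'

  forces-isolatedWhite : ∀ {B u w} → u ∈ B → w ∉ B → Adj G u w →
    (∀ y → y ∉ B → ¬ Adj G w y) → Forces G B u w
  forces-isolatedWhite {B} {w = w} u∈B w∉B uw isolated = u∈B , w∉B , uw , λ _ _ _ → onlyItself
    where
    onlyItself : ∀ {z} → WhiteReach G B w z → z ≡ w
    onlyItself (here _)      = refl
    onlyItself (step _ wy r) = ⊥-elim (isolated _ (whiteReach-source∉ r) wy)

  colours-none : ColoursAll (λ _ → ⊥)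
  colours-none B white⊆∅ = all-black λ v → black-outside white⊆∅ (λ ())

  colours-weaken : ∀ {W W'} → (∀ v → W v → W' v) → ColoursAll W' → ColoursAll W
  colours-weaken W⊆W' colours B white⊆W = colours B λ v v∉B → W⊆W' v (white⊆W v v∉B)

  colours-step : ∀ {W W'} w → (∀ v → W v → v ≢ w → W' v) →
    ForcibleIn W w → ColoursAll W' → ColoursAll W
  colours-step {W} {W'} w shrink forcible colours B white⊆W with w ∈? B
  ... | yes w∈B = colours B λ v v∉B → shrink v (white⊆W v v∉B) λ { refl → v∉B w∈B }
  ... | no  w∉B with forcible B white⊆W w∉B
  ...   | u , u→w = force u w u→w (colours (B ∪ ⁅ w ⁆) white⊆W')
    where
    white⊆W' : WhitesIn W' (B ∪ ⁅ w ⁆)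
    white⊆W' v v∉ = shrink v (white⊆W v (λ v∈B → v∉ (x∈p∪q⁺ (inj₁ v∈B))))
                      λ { refl → v∉ (x∈p∪q⁺ (inj₂ (x∈⁅x⁆ w))) }

  pzfsLeaving : ∀ {W m} (Ws : Subset n) → (∀ v → v ∈ Ws → W v) → ColoursAll W →
    m ≤ ∣ Ws ∣ → PZFSLeaving G m
  pzfsLeaving {m = m} Ws Ws⊆W colours m≤ = ∁ Ws , colours (∁ Ws) (λ v v∉ → Ws⊆W v (x∉∁p⇒x∈p v∉)) , size
    where
    size : m + ∣ ∁ Ws ∣ ≤ n
    size = ≤-trans (+-monoˡ-≤ _ m≤) (≤-reflexive (trans (+-comm ∣ Ws ∣ _) (∣∁p∣+∣p∣≡n Ws)))

module CoveringBound {n c : ℕ} (G : Graph n) (K : Fin c → Subset n)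
                     (covering : IsCliqueCovering G K) where

  unfinished : Subset n → Subset c
  unfinished B = tabulate (λ a → not (does (K a ⊆? B)))

  unfinished⁺ : ∀ {B a} → ¬ (K a ⊆ B) → a ∈ unfinished B
  unfinished⁺ {B} {a} ¬Ka⊆B = lookup⇒[]= a (unfinished B) (trans (lookup∘tabulate _ a) (flag (K a ⊆? B)))
    where
    flag : (d : Dec (K a ⊆ B)) → not (does d) ≡ true
    flag (yes Ka⊆B) = ⊥-elim (¬Ka⊆B Ka⊆B)
    flag (no _)     = refl

  unfinished⁻ : ∀ {B a} → a ∈ unfinished B → ¬ (K a ⊆ B)
  unfinished⁻ {B} {a} a∈ = flag (K a ⊆? B) (trans (sym (lookup∘tabulate _ a)) ([]=⇒lookup a∈))
    where
    flag : (d : Dec (K a ⊆ B)) → not (does d) ≡ true → ¬ (K a ⊆ B)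
    flag (yes _)      ()
    flag (no ¬Ka⊆B) _ = ¬Ka⊆B

  force-completesClique : ∀ {B u w} → Forces G B u w → ∃ λ a → w ∈ K a × K a ⊆ B ∪ ⁅ w ⁆
  force-completesClique {B} {u} {w} (u∈B , w∉B , uw , unique) with proj₂ covering u w uw
  ... | a , u∈Ka , w∈Ka = a , w∈Ka , Ka⊆
    where
    Ka⊆ : K a ⊆ B ∪ ⁅ w ⁆
    Ka⊆ {v} v∈Ka with v ∈? B | v ≟ᶠ w
    ... | yes v∈B | _        = x∈p∪q⁺ (inj₁ v∈B)
    ... | no _    | yes refl = x∈p∪q⁺ (inj₂ (x∈⁅x⁆ w))
    ... | no v∉B  | no v≢w   = ⊥-elim (v≢w (unique v v∉B
            (proj₁ covering a u v u∈Ka v∈Ka λ { refl → v∉B u∈B })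
            (step w∉B (proj₁ covering a w v w∈Ka v∈Ka λ { refl → v≢w refl }) (here v∉B))))

  force-shrinksUnfinished : ∀ {B u w} → Forces G B u w → ∣ unfinished (B ∪ ⁅ w ⁆) ∣ < ∣ unfinished B ∣
  force-shrinksUnfinished {B} {w = w} u→w@(_ , w∉B , _) with force-completesClique u→w
  ... | a , w∈Ka , Ka⊆ =
    p⊂q⇒∣p∣<∣q∣ (shrink , a , unfinished⁺ (λ Ka⊆B → w∉B (Ka⊆B w∈Ka)) , λ a∈ → unfinished⁻ a∈ Ka⊆)
    where
    shrink : unfinished (B ∪ ⁅ w ⁆) ⊆ unfinished B
    shrink a∈ = unfinished⁺ λ Ka⊆B → unfinished⁻ a∈ (λ v∈ → x∈p∪q⁺ (inj₁ (Ka⊆B v∈)))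

  n≤∣B∣+∣unfinished∣ : ∀ {B} → CanColourAll G B → n ≤ ∣ B ∣ + ∣ unfinished B ∣
  n≤∣B∣+∣unfinished∣ {B} (all-black allIn) = begin
    n         ≡⟨ ∣⊤∣≡n n ⟨
    ∣ ⊤ {n} ∣ ≤⟨ p⊆q⇒∣p∣≤∣q∣ {p = ⊤} (λ {v} _ → allIn v) ⟩
    ∣ B ∣     ≤⟨ m≤m+n _ _ ⟩
    ∣ B ∣ + ∣ unfinished B ∣ ∎
    where open ≤-Reasoning
  n≤∣B∣+∣unfinished∣ {B} (force u w u→w rest) = begin
    n                                      ≤⟨ n≤∣B∣+∣unfinished∣ rest ⟩
    ∣ B ∪ ⁅ w ⁆ ∣ + ∣ unfinished (B ∪ ⁅ w ⁆) ∣ ≤⟨ +-monoˡ-≤ _ (∣p∪⁅x⁆∣≤1+∣p∣ B w) ⟩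
    suc ∣ B ∣ + ∣ unfinished (B ∪ ⁅ w ⁆) ∣     ≡⟨ +-suc ∣ B ∣ _ ⟨
    ∣ B ∣ + suc ∣ unfinished (B ∪ ⁅ w ⁆) ∣     ≤⟨ +-monoʳ-≤ ∣ B ∣ (force-shrinksUnfinished u→w) ⟩
    ∣ B ∣ + ∣ unfinished B ∣                   ∎
    where open ≤-Reasoning

n≤zplus+cc : ∀ {n} (G : Graph n) {z c} → IsZPlus G z → IsCC G c → n ≤ z + c
n≤zplus+cc {n} G {z} {c} ((S , pzfs , ∣S∣≡z) , _) ((K , covering) , _) = begin
  n                            ≤⟨ n≤∣B∣+∣unfinished∣ pzfs ⟩
  ∣ S ∣ + ∣ unfinished S ∣      ≤⟨ +-mono-≤ (≤-reflexive ∣S∣≡z) (∣p∣≤n (unfinished S)) ⟩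
  z + c                        ∎
  where
  open ≤-Reasoning
  open CoveringBound G K covering

-- The cyclic order on the indices 0, …, L; `next` is only meaningful below L.
data CycSucc (L : ℕ) : ℕ → ℕ → Set where
  next : ∀ {a} → CycSucc L a (suc a)
  wrap : CycSucc L L 0

CycSucc-functional : ∀ {L a b c} → b ≤ L → c ≤ L → CycSucc L a b → CycSucc L a c → b ≡ c
CycSucc-functional _   _   next next = refl
CycSucc-functional b≤L _   next wrap = ⊥-elim (<-irrefl refl b≤L)
CycSucc-functional _   c≤L wrap next = ⊥-elim (<-irrefl refl c≤L)
CycSucc-functional _   _   wrap wrap = refl

CycSucc-injective : ∀ {L a a' b} → CycSucc L a b → CycSucc L a' b → a ≡ a'
CycSucc-injective next next = refl
CycSucc-injective wrap wrap = refl

CycSucc-irrefl : ∀ {L a} → 1 ≤ L → ¬ CycSucc L a a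
CycSucc-irrefl (s≤s _) ()

CycSucc-asym : ∀ {L a b} → 2 ≤ L → CycSucc L a b → ¬ CycSucc L b a
CycSucc-asym (s≤s (s≤s _)) next ()
CycSucc-asym (s≤s (s≤s _)) wrap ()

CycSucc-noTriangle : ∀ {L a b c} → 3 ≤ L → CycSucc L a b → CycSucc L b c → ¬ CycSucc L c a
CycSucc-noTriangle (s≤s (s≤s (s≤s _))) next next ()
CycSucc-noTriangle (s≤s (s≤s (s≤s _))) next wrap ()
CycSucc-noTriangle (s≤s (s≤s (s≤s _))) wrap next ()

CycSucc₂-total : ∀ a b → a ≤ 2 → b ≤ 2 → a ≢ b → CycSucc 2 a b ⊎ CycSucc 2 b a
CycSucc₂-total 0 1 _ _ _ = inj₁ next
CycSucc₂-total 1 2 _ _ _ = inj₁ next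
CycSucc₂-total 2 0 _ _ _ = inj₁ wrap
CycSucc₂-total 1 0 _ _ _ = inj₂ next
CycSucc₂-total 2 1 _ _ _ = inj₂ next
CycSucc₂-total 0 2 _ _ _ = inj₂ wrap
CycSucc₂-total 0 0 _ _ a≢b = ⊥-elim (a≢b refl)
CycSucc₂-total 1 1 _ _ a≢b = ⊥-elim (a≢b refl)
CycSucc₂-total 2 2 _ _ a≢b = ⊥-elim (a≢b refl)
CycSucc₂-total (suc (suc (suc _))) _ (s≤s (s≤s ())) _ _
CycSucc₂-total _ (suc (suc (suc _))) _ (s≤s (s≤s ())) _

thirdIndex : ∀ {J} → J ≤ 2 → J ≢ 0 →
  ∃ λ k → k ≤ 2 × k ≢ 0 × k ≢ J × (∀ a → a ≤ 2 → a ≡ 0 ⊎ a ≡ J ⊎ a ≡ k)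
thirdIndex {0} _ J≢0 = ⊥-elim (J≢0 refl)
thirdIndex {1} _ _ = 2 , ≤-refl , (λ ()) , (λ ()) , λ
  { 0 _ → inj₁ refl ; 1 _ → inj₂ (inj₁ refl) ; 2 _ → inj₂ (inj₂ refl) ; (suc (suc (suc _))) (s≤s (s≤s ())) }
thirdIndex {2} _ _ = 1 , s≤s z≤n , (λ ()) , (λ ()) , λ
  { 0 _ → inj₁ refl ; 1 _ → inj₂ (inj₂ refl) ; 2 _ → inj₂ (inj₁ refl) ; (suc (suc (suc _))) (s≤s (s≤s ())) }
thirdIndex {suc (suc (suc _))} (s≤s (s≤s ())) _

module CyclicShift (L : ℕ) where

  succ : ℕ → ℕ
  succ a with a ≟ L
  ... | yes _ = 0
  ... | no  _ = suc a

  succ-L : succ L ≡ 0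
  succ-L with L ≟ L
  ... | yes _   = refl
  ... | no  L≢L = ⊥-elim (L≢L refl)

  succ-< : ∀ {a} → a < L → succ a ≡ suc a
  succ-< {a} a<L with a ≟ L
  ... | yes refl = ⊥-elim (<-irrefl refl a<L)
  ... | no  _    = refl

  CycSucc-succ : ∀ {a} → a ≤ L → CycSucc L a (succ a)
  CycSucc-succ {a} a≤L with a ≟ L
  ... | yes refl = wrap
  ... | no  _    = next

  succ≤L : ∀ {a} → a ≤ L → succ a ≤ L
  succ≤L {a} a≤L with a ≟ L
  ... | yes _   = z≤n
  ... | no  a≢L = ≤∧≢⇒< a≤L a≢L

  CycSucc⇒≡succ : ∀ {a b} → a ≤ L → b ≤ L → CycSucc L a b → b ≡ succ a
  CycSucc⇒≡succ a≤L b≤L a→b = CycSucc-functional b≤L (succ≤L a≤L) a→b (CycSucc-succ a≤L)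

  succ-injective : ∀ {a b} → a ≤ L → b ≤ L → succ a ≡ succ b → a ≡ b
  succ-injective a≤L b≤L eq = CycSucc-injective (CycSucc-succ a≤L) (subst (CycSucc L _) (sym eq) (CycSucc-succ b≤L))

  succ-preserves : ∀ {a b} → a ≤ L → b ≤ L → CycSucc L a b → CycSucc L (succ a) (succ b)
  succ-preserves a≤L b≤L a→b rewrite CycSucc⇒≡succ a≤L b≤L a→b = CycSucc-succ (succ≤L a≤L)

  succ-reflects : ∀ {a b} → a ≤ L → b ≤ L → CycSucc L (succ a) (succ b) → CycSucc L a b
  succ-reflects a≤L b≤L sa→sb
    rewrite succ-injective b≤L (succ≤L a≤L) (CycSucc⇒≡succ (succ≤L a≤L) (succ≤L b≤L) sa→sb)
    = CycSucc-succ a≤L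

  pred : ℕ → ℕ
  pred zero    = L
  pred (suc a) = a

  pred≤L : ∀ {a} → a ≤ L → pred a ≤ L
  pred≤L {zero}  _     = ≤-refl
  pred≤L {suc a} a<L   = ≤-trans (n≤1+n a) a<L

  succ∘pred : ∀ {a} → a ≤ L → succ (pred a) ≡ a
  succ∘pred {zero}  _   = succ-L
  succ∘pred {suc a} a<L = succ-< a<L

  shift : ℕ → ℕ → ℕ
  shift zero    a = a
  shift (suc x) a = succ (shift x a)

  unshift : ℕ → ℕ → ℕ
  unshift zero    a = a
  unshift (suc x) a = unshift x (pred a)

  shift≤L : ∀ x {a} → a ≤ L → shift x a ≤ L
  shift≤L zero    a≤L = a≤L
  shift≤L (suc x) a≤L = succ≤L (shift≤L x a≤L)

  unshift≤L : ∀ x {a} → a ≤ L → unshift x a ≤ L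
  unshift≤L zero    a≤L = a≤L
  unshift≤L (suc x) a≤L = unshift≤L x (pred≤L a≤L)

  shift∘unshift : ∀ x {a} → a ≤ L → shift x (unshift x a) ≡ a
  shift∘unshift zero    _   = refl
  shift∘unshift (suc x) a≤L rewrite shift∘unshift x (pred≤L a≤L) = succ∘pred a≤L

  shift-injective : ∀ x {a b} → a ≤ L → b ≤ L → shift x a ≡ shift x b → a ≡ b
  shift-injective zero    _   _   eq = eq
  shift-injective (suc x) a≤L b≤L eq =
    shift-injective x a≤L b≤L (succ-injective (shift≤L x a≤L) (shift≤L x b≤L) eq)

  shift-preserves : ∀ x {a b} → a ≤ L → b ≤ L → CycSucc L a b → CycSucc L (shift x a) (shift x b)
  shift-preserves zero    _   _   a→b = a→b
  shift-preserves (suc x) a≤L b≤L a→b =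
    succ-preserves (shift≤L x a≤L) (shift≤L x b≤L) (shift-preserves x a≤L b≤L a→b)

  shift-reflects : ∀ x {a b} → a ≤ L → b ≤ L → CycSucc L (shift x a) (shift x b) → CycSucc L a b
  shift-reflects zero    _   _   a→b = a→b
  shift-reflects (suc x) a≤L b≤L a→b =
    shift-reflects x a≤L b≤L (succ-reflects (shift≤L x a≤L) (shift≤L x b≤L) a→b)

  shift-0 : ∀ x → x ≤ L → shift x 0 ≡ x
  shift-0 zero    _   = refl
  shift-0 (suc x) x<L rewrite shift-0 x (≤-trans (n≤1+n x) x<L) = succ-< x<L

PrivateTo : ∀ {n} → (ℕ → Subset n) → ℕ → ℕ → Fin n → Set
PrivateTo K L a v = v ∈ K a × (∀ b → b ≤ L → v ∈ K b → b ≡ a)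

-- The cycle of cliques relabelled so that the two cliques with private vertices are K 0 and K J;
-- K is indexed by ℕ but only K 0, …, K L are cliques of the covering.
record NormalCycle {n : ℕ} (L : ℕ) (G : Graph n) : Set where
  field
    K         : ℕ → Subset n
    K-clique  : ∀ a → IsClique G (K a)
    K-maximal : ∀ a w → w ∉ K a → ¬ IsClique G (⁅ w ⁆ ∪ K a)
    K-covers  : ∀ u v → Adj G u v → ∃ λ a → a ≤ L × u ∈ K a × v ∈ K a
    succ-meet : ∀ a b → a ≤ L → b ≤ L → CycSucc L a b → Meets (K a) (K b)
    meet⇒succ : ∀ a b → a ≤ L → b ≤ L → Meets (K a) (K b) → a ≡ b ⊎ CycSucc L a b ⊎ CycSucc L b a
    p₀        : Fin n
    p₀-private : PrivateTo K L 0 p₀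
    J         : ℕ
    J≤L       : J ≤ L
    J≢0       : J ≢ 0
    pJ        : Fin n
    pJ-private : PrivateTo K L J pJ

clamp : ∀ {L} → ℕ → Fin (suc L)
clamp {L}     zero    = fzero
clamp {zero}  (suc a) = fzero
clamp {suc L} (suc a) = fsuc (clamp {L} a)

toℕ-clamp : ∀ {L a} → a ≤ L → toℕ (clamp {L} a) ≡ a
toℕ-clamp {L}     {zero}  _         = refl
toℕ-clamp {suc L} {suc a} (s≤s a≤L) = cong suc (toℕ-clamp a≤L)

clamp-toℕ : ∀ {L} (k : Fin (suc L)) → clamp (toℕ k) ≡ k
clamp-toℕ k = toℕ-injective (toℕ-clamp (≤-pred (toℕ<n k)))

module Normalise {n L : ℕ} (G : Graph n) (C : Fin (suc L) → Subset n) (cycle : IsCycleOfCliques G C)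
  (i j : Fin (suc L)) (i≢j : i ≢ j) (privᵢ : PrivateNonempty C i) (privⱼ : PrivateNonempty C j) where
  open CyclicShift L

  index : ℕ → Fin (suc L)
  index a = clamp (shift (toℕ i) a)

  position : Fin (suc L) → ℕ
  position k = unshift (toℕ i) (toℕ k)

  position≤L : ∀ k → position k ≤ L
  position≤L k = unshift≤L (toℕ i) (≤-pred (toℕ<n k))

  toℕ-index : ∀ {a} → a ≤ L → toℕ (index a) ≡ shift (toℕ i) a
  toℕ-index a≤L = toℕ-clamp (shift≤L (toℕ i) a≤L)

  index-injective : ∀ {a b} → a ≤ L → b ≤ L → index a ≡ index b → a ≡ b
  index-injective a≤L b≤L eq =
    shift-injective (toℕ i) a≤L b≤L (trans (sym (toℕ-index a≤L)) (trans (cong toℕ eq) (toℕ-index b≤L)))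

  index-0 : index 0 ≡ i
  index-0 = trans (cong clamp (shift-0 (toℕ i) (≤-pred (toℕ<n i)))) (clamp-toℕ i)

  index∘position : ∀ k → index (position k) ≡ k
  index∘position k = trans (cong clamp (shift∘unshift (toℕ i) (≤-pred (toℕ<n k)))) (clamp-toℕ k)

  CycSucc-index⁺ : ∀ {a b} → a ≤ L → b ≤ L → CycSucc L a b → CycSucc L (toℕ (index a)) (toℕ (index b))
  CycSucc-index⁺ a≤L b≤L a→b =
    subst₂ (CycSucc L) (sym (toℕ-index a≤L)) (sym (toℕ-index b≤L)) (shift-preserves (toℕ i) a≤L b≤L a→b)

  CycSucc-index⁻ : ∀ {a b} → a ≤ L → b ≤ L → CycSucc L (toℕ (index a)) (toℕ (index b)) → CycSucc L a b
  CycSucc-index⁻ a≤L b≤L a→b =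
    shift-reflects (toℕ i) a≤L b≤L (subst₂ (CycSucc L) (toℕ-index a≤L) (toℕ-index b≤L) a→b)

  covering : IsCliqueCovering G C
  covering = proj₁ (proj₁ cycle)

  maximal : ∀ k → IsMaximalClique G (C k)
  maximal = proj₂ (proj₂ (proj₁ cycle))

  consecutive-meet : ∀ k k' → suc (toℕ k) ≡ toℕ k' → Meets (C k) (C k')
  consecutive-meet = proj₁ (proj₂ cycle)

  last-first-meet : ∀ k k' → toℕ k ≡ 0 → suc (toℕ k') ≡ suc L → Meets (C k) (C k')
  last-first-meet = proj₁ (proj₂ (proj₂ cycle))

  others-disjoint : ∀ k k' → k ≢ k' → ¬ CycAdj k k' → ¬ Meets (C k) (C k')
  others-disjoint = proj₂ (proj₂ (proj₂ cycle))

  meet-CycSucc : ∀ k k' → CycSucc L (toℕ k) (toℕ k') → Meets (C k) (C k')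
  meet-CycSucc k k' k→k' = meet k→k' refl refl
    where
    meet : ∀ {a b} → CycSucc L a b → a ≡ toℕ k → b ≡ toℕ k' → Meets (C k) (C k')
    meet next refl eq = consecutive-meet k k' eq
    meet wrap eq eq' with last-first-meet k' k (sym eq') (cong suc (sym eq))
    ... | v , v∈k' , v∈k = v , v∈k , v∈k'

  CycAdj? : ∀ (k k' : Fin (suc L)) → Dec (CycAdj k k')
  CycAdj? k k' = (suc (toℕ k) ≟ toℕ k') ⊎-dec (suc (toℕ k') ≟ toℕ k)
    ⊎-dec ((toℕ k ≟ 0) ×-dec (suc (toℕ k') ≟ suc L))
    ⊎-dec ((toℕ k' ≟ 0) ×-dec (suc (toℕ k) ≟ suc L))

  CycAdj⇒CycSucc : ∀ {k k' : Fin (suc L)} → CycAdj k k' →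
    CycSucc L (toℕ k) (toℕ k') ⊎ CycSucc L (toℕ k') (toℕ k)
  CycAdj⇒CycSucc (inj₁ eq)                        = inj₁ (subst (CycSucc L _) eq next)
  CycAdj⇒CycSucc (inj₂ (inj₁ eq))                 = inj₂ (subst (CycSucc L _) eq next)
  CycAdj⇒CycSucc (inj₂ (inj₂ (inj₁ (k≡0 , k'≡L)))) =
    inj₂ (subst₂ (CycSucc L) (sym (suc-injective k'≡L)) (sym k≡0) wrap)
  CycAdj⇒CycSucc (inj₂ (inj₂ (inj₂ (k'≡0 , k≡L)))) =
    inj₁ (subst₂ (CycSucc L) (sym (suc-injective k≡L)) (sym k'≡0) wrap)

  meet⇒CycSucc : ∀ a b → a ≤ L → b ≤ L → Meets (C (index a)) (C (index b)) →
    a ≡ b ⊎ CycSucc L a b ⊎ CycSucc L b a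
  meet⇒CycSucc a b a≤L b≤L meet with index a ≟ᶠ index b
  ... | yes eq = inj₁ (index-injective a≤L b≤L eq)
  ... | no neq with CycAdj? (index a) (index b)
  ... | no ¬adj = ⊥-elim (others-disjoint (index a) (index b) neq ¬adj meet)
  ... | yes adj with CycAdj⇒CycSucc adj
  ... | inj₁ a→b = inj₂ (inj₁ (CycSucc-index⁻ a≤L b≤L a→b))
  ... | inj₂ b→a = inj₂ (inj₂ (CycSucc-index⁻ b≤L a≤L b→a))

  position-i : position i ≡ 0
  position-i = index-injective (position≤L i) z≤n (trans (index∘position i) (sym index-0))

  privateTo : ∀ k (priv : PrivateNonempty C k) → PrivateTo (λ a → C (index a)) L (position k) (proj₁ priv)
  privateTo k (v , v∈k , v∉others) = subst (λ k → v ∈ C k) (sym (index∘position k)) v∈k , only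
    where
    only : ∀ b → b ≤ L → v ∈ C (index b) → b ≡ position k
    only b b≤L v∈ with index b ≟ᶠ k
    ... | yes eq  = index-injective b≤L (position≤L k) (trans eq (sym (index∘position k)))
    ... | no  neq = ⊥-elim (v∉others (index b) neq v∈)

  covers : ∀ u v → Adj G u v → ∃ λ a → a ≤ L × u ∈ C (index a) × v ∈ C (index a)
  covers u v uv with proj₂ covering u v uv
  ... | k , u∈k , v∈k = position k , position≤L k ,
        subst (u ∈_) (cong C (sym (index∘position k))) u∈k ,
        subst (v ∈_) (cong C (sym (index∘position k))) v∈k

  normalCycle : NormalCycle L G
  normalCycle = record
    { K          = λ a → C (index a)
    ; K-clique   = λ a → proj₁ covering (index a)
    ; K-maximal  = λ a → proj₂ (maximal (index a))
    ; K-covers   = covers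
    ; succ-meet  = λ a b a≤L b≤L a→b → meet-CycSucc (index a) (index b) (CycSucc-index⁺ a≤L b≤L a→b)
    ; meet⇒succ  = meet⇒CycSucc
    ; p₀         = proj₁ privᵢ
    ; p₀-private = subst (λ a → PrivateTo (λ a → C (index a)) L a (proj₁ privᵢ)) position-i (privateTo i privᵢ)
    ; J          = position j
    ; J≤L        = position≤L j
    ; J≢0        = λ eq → i≢j (trans (sym index-0) (trans (cong index (sym eq)) (index∘position j)))
    ; pJ         = proj₁ privⱼ
    ; pJ-private = privateTo j privⱼ
    }

module OnNormalCycle {n L : ℕ} {G : Graph n} (F : NormalCycle L G) where
  open NormalCycle F public
  open Forcing G public
  open CyclicShift L public

  private-unique : ∀ {a p b} → PrivateTo K L a p → b ≤ L → p ∈ K b → b ≡ a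
  private-unique (_ , unique) b≤L p∈Kb = unique _ b≤L p∈Kb

  private∉ : ∀ {a p b} → PrivateTo K L a p → b ≤ L → b ≢ a → p ∉ K b
  private∉ priv b≤L b≢a p∈Kb = b≢a (private-unique priv b≤L p∈Kb)

  shared≢private : ∀ {a b c u p} → a ≤ L → b ≤ L → a ≢ b → u ∈ K a → u ∈ K b →
    PrivateTo K L c p → u ≢ p
  shared≢private a≤L b≤L a≢b u∈Ka u∈Kb priv refl =
    a≢b (trans (private-unique priv a≤L u∈Ka) (sym (private-unique priv b≤L u∈Kb)))

  p₀≢pJ : p₀ ≢ pJ
  p₀≢pJ refl = J≢0 (private-unique p₀-private J≤L (proj₁ pJ-private))

  private⇒⊈ : ∀ {a b p} → PrivateTo K L b p → a ≤ L → a ≢ b → K a ⊈ K b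
  private⇒⊈ {a} {b} {p} priv a≤L a≢b Ka⊆Kb = K-maximal a p (private∉ priv a≤L a≢b) extended
    where
    into : ∀ {w} → w ∈ ⁅ p ⁆ ∪ K a → w ∈ K b
    into w∈ with x∈p∪q⁻ ⁅ p ⁆ (K a) w∈
    ... | inj₁ w∈p  = subst (_∈ K b) (sym (x∈⁅y⁆⇒x≡y p w∈p)) (proj₁ priv)
    ... | inj₂ w∈Ka = Ka⊆Kb w∈Ka
    extended : IsClique G (⁅ p ⁆ ∪ K a)
    extended u v u∈ v∈ = K-clique b u v (into u∈) (into v∈)

  -- p is isolated among the white vertices: all its neighbours lie in K a.
  forces-private : ∀ {a p u B} → PrivateTo K L a p → u ∈ K a → u ∈ B → p ∉ B → u ≢ p →
    (∀ y → y ∉ B → y ∈ K a → y ≡ p) → Forces G B u p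
  forces-private {a} {B = B} priv u∈Ka u∈B p∉B u≢p onlyWhite =
    forces-isolatedWhite u∈B p∉B (K-clique a _ _ u∈Ka (proj₁ priv) u≢p) isolated
    where
    isolated : ∀ y → y ∉ B → ¬ Adj G _ y
    isolated y y∉B py with K-covers _ y py
    ... | b , b≤L , p∈Kb , y∈Kb with private-unique priv b≤L p∈Kb
    ... | refl with onlyWhite y y∉B y∈Kb
    ... | refl = irrefl G py

  colours-private : ∀ {a p u} → PrivateTo K L a p → u ∈ K a → u ≢ p → ColoursAll (_≡ p)
  colours-private {p = p} priv u∈Ka u≢p = colours-step p (λ _ v≡p v≢p → v≢p v≡p) forcible colours-none
    where
    forcible : ForcibleIn (_≡ p) p
    forcible B whites p∉B =
      _ , forces-private priv u∈Ka (black-outside whites u≢p) p∉B u≢p (λ y y∉B _ → whites y y∉B)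

module TwoCliques {n : ℕ} {G : Graph n} (F : NormalCycle 1 G) where
  open OnNormalCycle F

  J≡1 : J ≡ 1
  J≡1 = ≤-antisym J≤L (n≢0⇒n>0 J≢0)

  shared : ∃ λ u → u ∈ K 0 × u ∈ K J
  shared = subst (λ b → ∃ λ u → u ∈ K 0 × u ∈ K b) (sym J≡1) (succ-meet 0 1 z≤n ≤-refl next)

  u : Fin n
  u = proj₁ shared

  u∈K0 : u ∈ K 0
  u∈K0 = proj₁ (proj₂ shared)

  u∈KJ : u ∈ K J
  u∈KJ = proj₂ (proj₂ shared)

  u≢private : ∀ {c p} → PrivateTo K 1 c p → u ≢ p
  u≢private = shared≢private z≤n J≤L (J≢0 ∘ sym) u∈K0 u∈KJ

  Whites : Fin n → Set
  Whites v = v ≡ p₀ ⊎ v ≡ pJ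

  forcible-p₀ : ForcibleIn Whites p₀
  forcible-p₀ B whites p₀∉B = u , forces-private p₀-private u∈K0 black p₀∉B (u≢private p₀-private) onlyWhite
    where
    black : u ∈ B
    black = black-outside whites λ { (inj₁ eq) → u≢private p₀-private eq ; (inj₂ eq) → u≢private pJ-private eq }
    onlyWhite : ∀ y → y ∉ B → y ∈ K 0 → y ≡ p₀
    onlyWhite y y∉B y∈K0 with whites y y∉B
    ... | inj₁ eq   = eq
    ... | inj₂ refl = ⊥-elim (private∉ pJ-private z≤n (J≢0 ∘ sym) y∈K0)

  colours : ColoursAll Whites
  colours = colours-step p₀ (λ { _ (inj₁ eq) v≢p₀ → ⊥-elim (v≢p₀ eq) ; _ (inj₂ eq) _ → eq }) forcible-p₀
              (colours-private pJ-private u∈KJ (u≢private pJ-private))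

  pzfs : PZFSLeaving G 2
  pzfs = pzfsLeaving (⁅ p₀ ⁆ ∪ ⁅ pJ ⁆) members colours (x≢y⇒2≤∣⁅x⁆∪⁅y⁆∣ p₀≢pJ)
    where
    members : ∀ v → v ∈ ⁅ p₀ ⁆ ∪ ⁅ pJ ⁆ → Whites v
    members v v∈ with x∈p∪⁅y⁆⁻ v∈
    ... | inj₁ v∈p₀ = inj₁ (x∈⁅y⁆⇒x≡y p₀ v∈p₀)
    ... | inj₂ v≡pJ = inj₂ v≡pJ

module ThreeCliques {n : ℕ} {G : Graph n} (F : NormalCycle 2 G) (k : ℕ) (k≤2 : k ≤ 2) (k≢0 : k ≢ 0)
  (k≢J : k ≢ NormalCycle.J F) (index-cases : ∀ a → a ≤ 2 → a ≡ 0 ⊎ a ≡ NormalCycle.J F ⊎ a ≡ k) where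
  open OnNormalCycle F

  meet : ∀ {a b} → a ≤ 2 → b ≤ 2 → a ≢ b → Meets (K a) (K b)
  meet {a} {b} a≤2 b≤2 a≢b with CycSucc₂-total a b a≤2 b≤2 a≢b
  ... | inj₁ a→b = succ-meet a b a≤2 b≤2 a→b
  ... | inj₂ b→a with succ-meet b a b≤2 a≤2 b→a
  ...   | v , v∈Kb , v∈Ka = v , v∈Ka , v∈Kb

  private-k : ∀ {x} → x ∈ K k → x ∉ K 0 → x ∉ K J → PrivateTo K 2 k x
  private-k {x} x∈Kk x∉K0 x∉KJ = x∈Kk , only
    where
    only : ∀ b → b ≤ 2 → x ∈ K b → b ≡ k
    only b b≤2 x∈Kb with index-cases b b≤2
    ... | inj₁ refl        = ⊥-elim (x∉K0 x∈Kb)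
    ... | inj₂ (inj₁ refl) = ⊥-elim (x∉KJ x∈Kb)
    ... | inj₂ (inj₂ b≡k)  = b≡k

  Whites₃ Whites₂ : Fin n → Fin n → Set
  Whites₃ x v = v ≡ p₀ ⊎ v ≡ pJ ⊎ v ≡ x
  Whites₂ x v = v ≡ pJ ⊎ v ≡ x

  colours-p₀-first : ∀ {x} → x ∉ K 0 → ColoursAll (Whites₂ x) → ColoursAll (Whites₃ x)
  colours-p₀-first {x} x∉K0 = colours-step p₀ drop forcible
    where
    drop : ∀ v → Whites₃ x v → v ≢ p₀ → Whites₂ x v
    drop _ (inj₁ eq) v≢p₀ = ⊥-elim (v≢p₀ eq)
    drop _ (inj₂ w) _     = w
    forcible : ForcibleIn (Whites₃ x) p₀
    forcible B whites p₀∉B with meet z≤n J≤L (J≢0 ∘ sym)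
    ... | u , u∈K0 , u∈KJ = u , forces-private p₀-private u∈K0 black p₀∉B (u≢ p₀-private) onlyWhite
      where
      u≢ : ∀ {c p} → PrivateTo K 2 c p → u ≢ p
      u≢ = shared≢private z≤n J≤L (J≢0 ∘ sym) u∈K0 u∈KJ
      black : u ∈ B
      black = black-outside whites λ
        { (inj₁ eq)        → u≢ p₀-private eq
        ; (inj₂ (inj₁ eq)) → u≢ pJ-private eq
        ; (inj₂ (inj₂ eq)) → ∈∉⇒≢ u∈K0 x∉K0 eq }
      onlyWhite : ∀ y → y ∉ B → y ∈ K 0 → y ≡ p₀
      onlyWhite y y∉B y∈K0 with whites y y∉B
      ... | inj₁ eq          = eq
      ... | inj₂ (inj₁ refl) = ⊥-elim (private∉ pJ-private z≤n (J≢0 ∘ sym) y∈K0)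
      ... | inj₂ (inj₂ refl) = ⊥-elim (x∉K0 y∈K0)

  -- A vertex u of K J ∩ K k forces pJ and then x.
  colours-privateThird : ∀ {x} → PrivateTo K 2 k x → ColoursAll (Whites₂ x)
  colours-privateThird {x} privₓ with meet J≤L k≤2 (k≢J ∘ sym)
  ... | u , u∈KJ , u∈Kk = colours-step pJ drop forcible (colours-private privₓ u∈Kk (u≢ privₓ))
    where
    u≢ : ∀ {c p} → PrivateTo K 2 c p → u ≢ p
    u≢ = shared≢private J≤L k≤2 (k≢J ∘ sym) u∈KJ u∈Kk
    drop : ∀ v → Whites₂ x v → v ≢ pJ → v ≡ x
    drop _ (inj₁ eq) v≢pJ = ⊥-elim (v≢pJ eq)
    drop _ (inj₂ eq) _    = eq
    forcible : ForcibleIn (Whites₂ x) pJ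
    forcible B whites pJ∉B = u , forces-private pJ-private u∈KJ black pJ∉B (u≢ pJ-private) onlyWhite
      where
      black : u ∈ B
      black = black-outside whites λ { (inj₁ eq) → u≢ pJ-private eq ; (inj₂ eq) → u≢ privₓ eq }
      onlyWhite : ∀ y → y ∉ B → y ∈ K J → y ≡ pJ
      onlyWhite y y∉B y∈KJ with whites y y∉B
      ... | inj₁ eq   = eq
      ... | inj₂ refl = ⊥-elim (private∉ privₓ J≤L (k≢J ∘ sym) y∈KJ)

  -- y forces x, then x forces pJ.
  colours-sharedThird : ∀ {x y} → x ∈ K k → x ∈ K J → x ∉ K 0 → y ∈ K k → y ∈ K 0 → y ∉ K J →
    ColoursAll (Whites₂ x)
  colours-sharedThird {x} {y} x∈Kk x∈KJ x∉K0 y∈Kk y∈K0 y∉KJ =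
    colours-step x drop forcible (colours-private pJ-private x∈KJ x≢pJ)
    where
    x≢pJ : x ≢ pJ
    x≢pJ = shared≢private k≤2 J≤L k≢J x∈Kk x∈KJ pJ-private
    y≢x : y ≢ x
    y≢x = ∈∉⇒≢ y∈K0 x∉K0
    drop : ∀ v → Whites₂ x v → v ≢ x → v ≡ pJ
    drop _ (inj₁ eq) _   = eq
    drop _ (inj₂ eq) v≢x = ⊥-elim (v≢x eq)
    forcible : ForcibleIn (Whites₂ x) x
    forcible B whites x∉B = y , forces-uniqueWhiteNeighbour black x∉B (K-clique k y x y∈Kk x∈Kk y≢x) unique
      where
      black : y ∈ B
      black = black-outside whites λ
        { (inj₁ eq) → ∈∉⇒≢ y∈K0 (private∉ pJ-private z≤n (J≢0 ∘ sym)) eq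
        ; (inj₂ eq) → y≢x eq }
      unique : ∀ w → w ∉ B → Adj G y w → w ≡ x
      unique w w∉B yw with whites w w∉B
      ... | inj₂ eq   = eq
      ... | inj₁ refl with K-covers y pJ yw
      ...   | b , b≤2 , y∈Kb , pJ∈Kb =
        ⊥-elim (y∉KJ (subst (λ c → y ∈ K c) (private-unique pJ-private b≤2 pJ∈Kb) y∈Kb))

  pzfsLeaving-third : ∀ {x} → x ∈ K k → x ∉ K 0 → ColoursAll (Whites₂ x) → PZFSLeaving G 3
  pzfsLeaving-third {x} x∈Kk x∉K0 colours =
    pzfsLeaving ((⁅ p₀ ⁆ ∪ ⁅ pJ ⁆) ∪ ⁅ x ⁆) members (colours-p₀-first x∉K0 colours) size
    where
    members : ∀ v → v ∈ (⁅ p₀ ⁆ ∪ ⁅ pJ ⁆) ∪ ⁅ x ⁆ → Whites₃ x v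
    members v v∈ with x∈p∪⁅y⁆⁻ v∈
    ... | inj₂ v≡x = inj₂ (inj₂ v≡x)
    ... | inj₁ v∈′ with x∈p∪⁅y⁆⁻ v∈′
    ...   | inj₁ v∈p₀ = inj₁ (x∈⁅y⁆⇒x≡y p₀ v∈p₀)
    ...   | inj₂ v≡pJ = inj₂ (inj₁ v≡pJ)
    x∉ : x ∉ ⁅ p₀ ⁆ ∪ ⁅ pJ ⁆
    x∉ x∈ with x∈p∪⁅y⁆⁻ x∈
    ... | inj₁ x∈p₀ = ∈∉⇒≢ (proj₁ p₀-private) x∉K0 (sym (x∈⁅y⁆⇒x≡y p₀ x∈p₀))
    ... | inj₂ x≡pJ = ∈∉⇒≢ x∈Kk (private∉ pJ-private k≤2 k≢J) x≡pJ
    size : 3 ≤ ∣ (⁅ p₀ ⁆ ∪ ⁅ pJ ⁆) ∪ ⁅ x ⁆ ∣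
    size = ≤-trans (s≤s (x≢y⇒2≤∣⁅x⁆∪⁅y⁆∣ p₀≢pJ)) (x∉p⇒∣p∣<∣p∪⁅x⁆∣ x∉)

  -- By maximality K k lies in neither K 0 nor K J.
  pzfs : PZFSLeaving G 3
  pzfs with ⊈⇒∃∈∉ (private⇒⊈ p₀-private k≤2 k≢0) | ⊈⇒∃∈∉ (private⇒⊈ pJ-private k≤2 k≢J)
  ... | x , x∈Kk , x∉K0 | y , y∈Kk , y∉KJ with x ∈? K J | y ∈? K 0
  ... | no x∉KJ  | _        = pzfsLeaving-third x∈Kk x∉K0 (colours-privateThird (private-k x∈Kk x∉K0 x∉KJ))
  ... | yes _    | no y∉K0  = pzfsLeaving-third y∈Kk y∉K0 (colours-privateThird (private-k y∈Kk y∉K0 y∉KJ))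
  ... | yes x∈KJ | yes y∈K0 =
    pzfsLeaving-third x∈Kk x∉K0 (colours-sharedThird x∈Kk x∈KJ x∉K0 y∈Kk y∈K0 y∉KJ)

module LongCycle {n L′ : ℕ} {G : Graph n} (F : NormalCycle (3 + L′) G) where
  open OnNormalCycle F

  L : ℕ
  L = 3 + L′

  -- A chosen vertex of K m ∩ K (succ m); the junk value p₀ beyond L is never used.
  link : ℕ → Fin n
  link m with m ≤? L
  ... | yes m≤L = proj₁ (succ-meet m (succ m) m≤L (succ≤L m≤L) (CycSucc-succ m≤L))
  ... | no  _   = p₀

  link∈ : ∀ {m} → m ≤ L → link m ∈ K m × link m ∈ K (succ m)
  link∈ {m} m≤L with m ≤? L
  ... | yes m≤L′ = proj₂ (succ-meet m (succ m) m≤L′ (succ≤L m≤L′) (CycSucc-succ m≤L′))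
  ... | no  m≰L  = ⊥-elim (m≰L m≤L)

  m≢succ : ∀ {m} → m ≤ L → m ≢ succ m
  m≢succ m≤L eq = CycSucc-irrefl (s≤s z≤n) (subst (CycSucc L _) (sym eq) (CycSucc-succ m≤L))

  -- Since the cycle has at least four cliques, no vertex lies in three of them.
  link-cliques : ∀ {m a} → m ≤ L → a ≤ L → link m ∈ K a → a ≡ m ⊎ a ≡ succ m
  link-cliques {m} {a} m≤L a≤L ∈Ka
    with meet⇒succ a m a≤L m≤L (link m , ∈Ka , proj₁ (link∈ m≤L))
       | meet⇒succ a (succ m) a≤L (succ≤L m≤L) (link m , ∈Ka , proj₂ (link∈ m≤L))
  ... | inj₁ a≡m              | _                 = inj₁ a≡m
  ... | inj₂ _                | inj₁ a≡sm         = inj₂ a≡sm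
  ... | inj₂ (inj₂ m→a)       | inj₂ _            = inj₂ (CycSucc⇒≡succ m≤L a≤L m→a)
  ... | inj₂ (inj₁ a→m)       | inj₂ (inj₁ a→sm)  =
    ⊥-elim (m≢succ m≤L (CycSucc-functional m≤L (succ≤L m≤L) a→m a→sm))
  ... | inj₂ (inj₁ a→m)       | inj₂ (inj₂ sm→a)  =
    ⊥-elim (CycSucc-noTriangle (s≤s (s≤s (s≤s z≤n))) a→m (CycSucc-succ m≤L) sm→a)

  link-injective : ∀ {m k} → m ≤ L → k ≤ L → link m ≡ link k → m ≡ k
  link-injective {m} {k} m≤L k≤L eq
    with link-cliques k≤L m≤L (subst (_∈ K m) eq (proj₁ (link∈ m≤L)))
       | link-cliques m≤L k≤L (subst (_∈ K k) (sym eq) (proj₁ (link∈ k≤L)))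
  ... | inj₁ m≡k   | _          = m≡k
  ... | inj₂ _     | inj₁ k≡m   = sym k≡m
  ... | inj₂ m≡sk  | inj₂ k≡sm  = ⊥-elim (CycSucc-asym (s≤s (s≤s z≤n))
          (subst (CycSucc L k) (sym m≡sk) (CycSucc-succ k≤L)) (subst (CycSucc L m) (sym k≡sm) (CycSucc-succ m≤L)))

  link≢private : ∀ {m c p} → m ≤ L → PrivateTo K L c p → link m ≢ p
  link≢private m≤L =
    shared≢private m≤L (succ≤L m≤L) (m≢succ m≤L) (proj₁ (link∈ m≤L)) (proj₂ (link∈ m≤L))

  link-neighbourLink : ∀ {m k} → m ≤ L → k ≤ L → Adj G (link m) (link k) → succ k ≡ m ⊎ k ≡ succ m
  link-neighbourLink {m} {k} m≤L k≤L mk with K-covers (link m) (link k) mk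
  ... | a , a≤L , m∈Ka , k∈Ka with link-cliques m≤L a≤L m∈Ka | link-cliques k≤L a≤L k∈Ka
  ...   | inj₁ refl  | inj₁ refl  = ⊥-elim (irrefl G mk)
  ...   | inj₁ refl  | inj₂ a≡sk  = inj₁ (sym a≡sk)
  ...   | inj₂ a≡sm  | inj₁ refl  = inj₂ a≡sm
  ...   | inj₂ a≡sm  | inj₂ a≡sk  with succ-injective m≤L k≤L (trans (sym a≡sm) a≡sk)
  ...     | refl = ⊥-elim (irrefl G mk)

  link-neighbourPrivate : ∀ {m c p} → m ≤ L → PrivateTo K L c p → Adj G (link m) p → c ≡ m ⊎ c ≡ succ m
  link-neighbourPrivate m≤L priv mp with K-covers _ _ mp
  ... | a , a≤L , m∈Ka , p∈Ka with private-unique priv a≤L p∈Ka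
  ...   | refl = link-cliques m≤L a≤L m∈Ka

  succ-avoids : ∀ {a x} → a ≤ L → 0 < x → x ≤ a → x ≢ succ a
  succ-avoids {a} a≤L 0<x x≤a eq with a ≟ L
  ... | yes _ = <-irrefl (sym eq) 0<x
  ... | no  _ = <-irrefl refl (subst (_≤ a) eq x≤a)

  Whites : ℕ → ℕ → Fin n → Set
  Whites t s v = (∃ λ m → t ≤ m × m < s × v ≡ link m) ⊎ v ≡ pJ

  link-notWhite : ∀ {m t s} → m ≤ L → s ≤ L → (∀ {k} → t ≤ k → k < s → k ≢ m) → ¬ Whites t s (link m)
  link-notWhite m≤L s≤L outside (inj₁ (k , t≤k , k<s , eq)) =
    outside t≤k k<s (link-injective (≤-trans (<⇒≤ k<s) s≤L) m≤L (sym eq))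
  link-notWhite m≤L _   _       (inj₂ eq) = link≢private m≤L pJ-private eq

  -- The links are forced from both ends of the cycle towards K J: below J by their left
  -- neighbour, from L down to J by their right neighbour; finally link J forces pJ.
  forcible-forward : ∀ {t} → suc t < J → ForcibleIn (Whites (suc t) L) (link (suc t))
  forcible-forward {t} t+1<J B whites w∉B = link t , forces-uniqueWhiteNeighbour black w∉B adj unique
    where
    t+1≤L : suc t ≤ L
    t+1≤L = ≤-trans (<⇒≤ t+1<J) J≤L
    t≤L : t ≤ L
    t≤L = ≤-trans (n≤1+n t) t+1≤L
    succ-t : succ t ≡ suc t
    succ-t = succ-< t+1≤L
    black : link t ∈ B
    black = black-outside whites (link-notWhite t≤L ≤-refl λ t<k _ k≡t → <-irrefl (sym k≡t) t<k)
    adj : Adj G (link t) (link (suc t))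
    adj = K-clique (suc t) _ _ (subst (λ a → link t ∈ K a) succ-t (proj₂ (link∈ t≤L))) (proj₁ (link∈ t+1≤L))
            λ eq → <-irrefl (link-injective t≤L t+1≤L eq) ≤-refl
    unique : ∀ w → w ∉ B → Adj G (link t) w → w ≡ link (suc t)
    unique w w∉B tw with whites w w∉B
    ... | inj₁ (k , t<k , k<L , refl) with link-neighbourLink t≤L (<⇒≤ k<L) tw
    ...   | inj₁ sk≡t = ⊥-elim (<-irrefl (sym (trans (sym (succ-< k<L)) sk≡t)) (≤-trans t<k (n≤1+n k)))
    ...   | inj₂ k≡st = cong link (trans k≡st succ-t)
    unique w w∉B tw | inj₂ refl with link-neighbourPrivate t≤L pJ-private tw
    ...   | inj₁ J≡t  = ⊥-elim (<-irrefl (sym J≡t) (≤-trans (n≤1+n _) t+1<J))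
    ...   | inj₂ J≡st = ⊥-elim (<-irrefl (sym (trans J≡st succ-t)) t+1<J)

  forcible-backward : ∀ {s} → J ≤ s → suc s ≤ L → ForcibleIn (Whites J (suc s)) (link s)
  forcible-backward {s} J≤s s+1≤L B whites w∉B = link (suc s) , forces-uniqueWhiteNeighbour black w∉B adj unique
    where
    s≤L : s ≤ L
    s≤L = ≤-trans (n≤1+n s) s+1≤L
    succ-s : succ s ≡ suc s
    succ-s = succ-< s+1≤L
    0<J : 0 < J
    0<J = n≢0⇒n>0 J≢0
    black : link (suc s) ∈ B
    black = black-outside whites (link-notWhite s+1≤L s+1≤L λ _ k<s+1 k≡s+1 → <-irrefl k≡s+1 k<s+1)
    adj : Adj G (link (suc s)) (link s)
    adj = K-clique (suc s) _ _ (proj₁ (link∈ s+1≤L)) (subst (λ a → link s ∈ K a) succ-s (proj₂ (link∈ s≤L)))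
            λ eq → <-irrefl (sym (link-injective s+1≤L s≤L eq)) ≤-refl
    unique : ∀ w → w ∉ B → Adj G (link (suc s)) w → w ≡ link s
    unique w w∉B sw with whites w w∉B
    ... | inj₁ (k , J≤k , k<s+1 , refl) with link-neighbourLink s+1≤L (≤-trans (<⇒≤ k<s+1) s+1≤L) sw
    ...   | inj₁ sk≡s+1 = cong link (suc-injective (trans (sym (succ-< (≤-trans k<s+1 s+1≤L))) sk≡s+1))
    ...   | inj₂ k≡ss   = ⊥-elim (succ-avoids s+1≤L (≤-trans 0<J J≤k) (<⇒≤ k<s+1) k≡ss)
    unique w w∉B sw | inj₂ refl with link-neighbourPrivate s+1≤L pJ-private sw
    ...   | inj₁ J≡s+1  = ⊥-elim (<-irrefl J≡s+1 (s≤s J≤s))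
    ...   | inj₂ J≡ss   = ⊥-elim (succ-avoids s+1≤L 0<J (≤-trans J≤s (n≤1+n s)) J≡ss)

  colours-backward : ∀ d → d + J ≤ L → ColoursAll (Whites J (d + J))
  colours-backward zero _ =
    colours-weaken onlyPJ (colours-private pJ-private (proj₁ (link∈ J≤L)) (link≢private J≤L pJ-private))
    where
    onlyPJ : ∀ v → Whites J J v → v ≡ pJ
    onlyPJ _ (inj₁ (_ , J≤m , m<J , _)) = ⊥-elim (<-irrefl refl (≤-trans m<J J≤m))
    onlyPJ _ (inj₂ eq)                  = eq
  colours-backward (suc d) bound =
    colours-step (link (d + J)) drop (forcible-backward (m≤n+m J d) bound) (colours-backward d (≤-trans (n≤1+n _) bound))
    where
    drop : ∀ v → Whites J (suc (d + J)) v → v ≢ link (d + J) → Whites J (d + J) v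
    drop _ (inj₂ eq) _ = inj₂ eq
    drop _ (inj₁ (m , J≤m , m<s , eq)) v≢ =
      inj₁ (m , J≤m , ≤∧≢⇒< (≤-pred m<s) (λ m≡ → v≢ (trans eq (cong link m≡))) , eq)

  colours-forward : ∀ d t → d + t ≡ J → 1 ≤ t → ColoursAll (Whites t L)
  colours-forward zero t refl _ =
    subst (λ s → ColoursAll (Whites J s)) (m∸n+n≡m J≤L)
          (colours-backward (L ∸ J) (≤-reflexive (m∸n+n≡m J≤L)))
  colours-forward (suc d) (suc t) eq _ =
    colours-step (link (suc t)) drop (forcible-forward t+1<J)
                 (colours-forward d (suc (suc t)) (trans (+-suc d (suc t)) eq) (s≤s z≤n))
    where
    t+1<J : suc t < J
    t+1<J = subst (suc t <_) eq (s≤s (m≤n+m (suc t) d))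
    drop : ∀ v → Whites (suc t) L v → v ≢ link (suc t) → Whites (suc (suc t)) L v
    drop _ (inj₂ eq) _ = inj₂ eq
    drop _ (inj₁ (m , t<m , m<L , eq)) v≢ =
      inj₁ (m , ≤∧≢⇒< t<m (λ m≡ → v≢ (trans eq (cong link (sym m≡)))) , m<L , eq)

  Whites₀ : Fin n → Set
  Whites₀ v = v ≡ p₀ ⊎ Whites 1 L v

  forcible-p₀ : ForcibleIn Whites₀ p₀
  forcible-p₀ B whites p₀∉B =
    link 0 , forces-private p₀-private (proj₁ (link∈ z≤n)) black p₀∉B (link≢private z≤n p₀-private) onlyWhite
    where
    black : link 0 ∈ B
    black = black-outside whites λ
      { (inj₁ eq) → link≢private z≤n p₀-private eq
      ; (inj₂ w)  → link-notWhite z≤n ≤-refl (λ 1≤k _ k≡0 → <-irrefl (sym k≡0) 1≤k) w }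
    onlyWhite : ∀ y → y ∉ B → y ∈ K 0 → y ≡ p₀
    onlyWhite y y∉B y∈K0 with whites y y∉B
    ... | inj₁ eq          = eq
    ... | inj₂ (inj₂ refl) = ⊥-elim (private∉ pJ-private z≤n (J≢0 ∘ sym) y∈K0)
    ... | inj₂ (inj₁ (m , 1≤m , m<L , refl)) with link-cliques (<⇒≤ m<L) z≤n y∈K0
    ...   | inj₁ 0≡m  = ⊥-elim (<-irrefl 0≡m 1≤m)
    ...   | inj₂ 0≡sm = ⊥-elim (0≢1+n (trans 0≡sm (succ-< m<L)))

  colours : ColoursAll Whites₀
  colours = colours-step p₀ drop forcible-p₀ (colours-forward (J ∸ 1) 1 (m∸n+n≡m (n≢0⇒n>0 J≢0)) ≤-refl)
    where
    drop : ∀ v → Whites₀ v → v ≢ p₀ → Whites 1 L v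
    drop _ (inj₁ eq) v≢p₀ = ⊥-elim (v≢p₀ eq)
    drop _ (inj₂ w)  _    = w

  innerLinks : Subset n
  innerLinks = image (link ∘ suc) (2 + L′)

  whiteSet : Subset n
  whiteSet = (innerLinks ∪ ⁅ pJ ⁆) ∪ ⁅ p₀ ⁆

  ∈innerLinks⁻ : ∀ {v} → v ∈ innerLinks → ∃ λ m → 1 ≤ m × m < L × v ≡ link m
  ∈innerLinks⁻ v∈ with ∈-image⁻ (2 + L′) v∈
  ... | m , m<2+L′ , eq = suc m , s≤s z≤n , s≤s m<2+L′ , eq

  whiteSet⊆Whites₀ : ∀ v → v ∈ whiteSet → Whites₀ v
  whiteSet⊆Whites₀ v v∈ with x∈p∪⁅y⁆⁻ v∈
  ... | inj₂ v≡p₀ = inj₁ v≡p₀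
  ... | inj₁ v∈′ with x∈p∪⁅y⁆⁻ v∈′
  ...   | inj₁ v∈inner = inj₂ (inj₁ (∈innerLinks⁻ v∈inner))
  ...   | inj₂ v≡pJ    = inj₂ (inj₂ v≡pJ)

  ∣whiteSet∣ : suc L ≤ ∣ whiteSet ∣
  ∣whiteSet∣ =
    ≤-trans (s≤s (≤-trans (s≤s inner-size) (x∉p⇒∣p∣<∣p∪⁅x⁆∣ pJ∉))) (x∉p⇒∣p∣<∣p∪⁅x⁆∣ p₀∉)
    where
    inner-size : 2 + L′ ≤ ∣ innerLinks ∣
    inner-size = k≤∣image∣ (2 + L′) λ a< b< eq →
      suc-injective (link-injective (≤-trans a< (n≤1+n _)) (≤-trans b< (n≤1+n _)) eq)
    pJ∉ : pJ ∉ innerLinks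
    pJ∉ pJ∈ with ∈innerLinks⁻ pJ∈
    ... | m , _ , m<L , eq = link≢private (<⇒≤ m<L) pJ-private (sym eq)
    p₀∉ : p₀ ∉ innerLinks ∪ ⁅ pJ ⁆
    p₀∉ p₀∈ with x∈p∪⁅y⁆⁻ p₀∈
    ... | inj₂ p₀≡pJ = p₀≢pJ p₀≡pJ
    ... | inj₁ p₀∈inner with ∈innerLinks⁻ p₀∈inner
    ...   | m , _ , m<L , eq = link≢private (<⇒≤ m<L) p₀-private (sym eq)

  pzfs : PZFSLeaving G (suc L)
  pzfs = pzfsLeaving whiteSet whiteSet⊆Whites₀ colours ∣whiteSet∣

pzfsLeaving-cycle : ∀ {n L} {G : Graph n} → NormalCycle L G → PZFSLeaving G (suc L)
pzfsLeaving-cycle {L = 0}                   F = ⊥-elim (NormalCycle.J≢0 F (n≤0⇒n≡0 (NormalCycle.J≤L F)))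
pzfsLeaving-cycle {L = 1}                   F = TwoCliques.pzfs F
pzfsLeaving-cycle {L = 2}                   F with thirdIndex (NormalCycle.J≤L F) (NormalCycle.J≢0 F)
... | k , k≤2 , k≢0 , k≢J , index-cases = ThreeCliques.pzfs F k k≤2 k≢0 k≢J index-cases
pzfsLeaving-cycle {L = suc (suc (suc L′))} F = LongCycle.pzfs F

theorem11p6 : {n ℓ : ℕ} (G : Graph n) (C : Fin ℓ → Subset n) →
    IsCycleOfCliques G C →
    (i j : Fin ℓ) → i ≢ j → PrivateNonempty C i → PrivateNonempty C j →
    (z c : ℕ) → IsZPlus G z → IsCC G c → z + c ≡ n
theorem11p6 {ℓ = zero}  G C cycle () j i≢j privᵢ privⱼ z c zplus cc
theorem11p6 {ℓ = suc L} G C cycle i j i≢j privᵢ privⱼ z c zplus cc =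
  ≤-antisym (subst (λ c → z + c ≤ _) (sym c≡ℓ) (zplus+m≤n zplus (pzfsLeaving-cycle normalCycle)))
            (n≤zplus+cc G zplus cc)
  where
  open Normalise G C cycle i j i≢j privᵢ privⱼ using (normalCycle)
  c≡ℓ : c ≡ suc L
  c≡ℓ = IsMinimum-unique cc (proj₁ (proj₂ (proj₁ cycle)))
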